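{- For each semantic signature $S$ in $\mathbf{Set}$, define the polynomial functor $F_S X = \sum_{(\mathtt{op}:A_{\mathtt{op}}\to B_{\mathtt{op}})\in S} A_{\mathtt{op}}\times B_{\mathtt{op}}^{X}$ — more precisely $A_{\mathtt{op}}\times X^{B_{\mathtt{op}}}$ (the set of functions $B_{\mathtt{op}}\to X$) — and let $T_S$ be the free monad on $F_S$ with $\zeta : F_S \to T_S$. Then $\{T_S\}_S$ together with the following is a $\lambda_{\mathrm{eff}}$-model on $\mathbf{Set}$: $[\![\mathtt{op}]\!]$ is the composite $A_{\mathtt{op}} \to A_{\mathtt{op}}\times B_{\mathtt{op}}^{B_{\mathtt{op}}} \xrightarrow{\iota_{\mathtt{op}}} F_S B_{\mathtt{op}} \xrightarrow{\zeta} T_S B_{\mathtt{op}}$ (pairing with the identity function); and for $X$, an element $h\in\mathcal{H}_S(X)$ is equivalently an $F_S$-algebra structure $h'$ on $T_{S'}X$, and $\mathrm{handle}_{S,S',X}(h,-) : T_S T_{S'}X\to T_{S'}X$ is the Eilenberg–Moore $T_S$-algebra with $\mathrm{handle}(h,-)\circ\zeta = h'$.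
   Context: A semantic signature $S$ in a category is a finite partial map from operation symbols to pairs of objects; an entry $\mathtt{op}:A\to B$ means $S(\mathtt{op})=(A,B)$ (this arrow is the operation-signature arrow, not a morphism). A free monad for an endofunctor $F$ is a monad $T$ with $\zeta:F\to T$ universal among natural transformations from $F$ into monads; on $\mathbf{Set}$ free monads on polynomial functors exist and are algebraically free (Eilenberg–Moore $T$-algebras correspond to $F$-algebras over $\mathbf{Set}$). For a monad $T'$ on $\mathbf{Set}$, the Kleisli exponential is $(Y\Rightarrow_{T'}Z)=(T'Z)^Y$ and $\mathcal{H}_S(X)=\prod_{(\mathtt{op}:A_{\mathtt{op}}\to B_{\mathtt{op}})\in S}\big((A_{\mathtt{op}}\times (T_{S'}X)^{B_{\mathtt{op}}})\Rightarrow (T_{S'}X)\big)$. A $\lambda_{\mathrm{eff}}$-model consists of a cartesian category $\mathcal{C}$, strong monads $T_S$ indexed by semantic signatures with Kleisli exponentials, morphisms $[\![\mathtt{op}]\!]_S:A_{\mathtt{op}}\to T_S B_{\mathtt{op}}$, and $\mathrm{handle}_{S,S',X}:\mathcal{H}_S(X)\times T_S T_{S'}X\to T_{S'}X$ satisfying $\mathrm{handle}\circ(\mathrm{id}\times\eta^{T_S})=\pi_2$, $\mathrm{handle}\circ(\mathrm{id}\times\mu^{T_S})=\mathrm{handle}\circ(\mathrm{id}\times T_S\mathrm{handle})\circ\langle\pi_1,\mathrm{st}\rangle$, and $\mathrm{handle}\circ(\mathrm{id}\times a_{\mathtt{op}})=\mathrm{ev}\circ(\pi_{\mathtt{op}}\times\mathrm{id})$,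 where $a_{\mathtt{op}}=T_S\mathrm{ev}\circ\mathrm{st}\circ\mathrm{swap}\circ([\![\mathtt{op}]\!]_S\times\mathrm{id}):A_{\mathtt{op}}\times(B_{\mathtt{op}}\Rightarrow_{T_{S'}}X)\to T_ST_{S'}X$. -}

module Defs where

open import Data.Nat using (ℕ)
open import Data.Fin using (Fin)
open import Data.Product using (Σ; _×_; _,_; proj₁; proj₂; map)
open import Function using (id; _∘_)
open import Relation.Binary.PropositionalEquality using (_≡_)

-- Semantic signatures in Set: a finite partial map from operation
-- symbols (here: natural numbers) to pairs of sets.  The entries are
-- indexed by Fin size; `name` gives the symbol of each entry and is
-- injective (so it is a partial map), `A`/`B` give A_op and B_op.

record Sig : Set₁ where
  field
    size     : ℕ
    name     : Fin size → ℕ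
    name-inj : ∀ {i j} → name i ≡ name j → i ≡ j
    A        : Fin size → Set
    B        : Fin size → Set
open Sig public

Op : Sig → Set
Op S = Fin (size S)

record IsStrongMonad (T : Set → Set)
    (fmap : ∀ {X Y : Set} → (X → Y) → T X → T Y)
    (η : ∀ {X : Set} → X → T X)
    (μ : ∀ {X : Set} → T (T X) → T X)
    (st : ∀ {X Y : Set} → X × T Y → T (X × Y)) : Set₁ where
  field
    fmap-id : ∀ {X} (t : T X) → fmap id t ≡ t
    fmap-∘  : ∀ {X Y Z} (f : X → Y) (g : Y → Z) (t : T X) →
              fmap (g ∘ f) t ≡ fmap g (fmap f t)
    η-nat   : ∀ {X Y} (f : X → Y) (x : X) → fmap f (η x) ≡ η (f x)
    μ-nat   : ∀ {X Y} (f : X → Y) (t : T (T X)) →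
              fmap f (μ t) ≡ μ (fmap (fmap f) t)
    μ-η     : ∀ {X} (t : T X) → μ (η t) ≡ t
    μ-Tη    : ∀ {X} (t : T X) → μ (fmap η t) ≡ t
    μ-Tμ    : ∀ {X} (t : T (T (T X))) → μ (fmap μ t) ≡ μ (μ t)
    st-nat  : ∀ {X X' Y Y'} (f : X → X') (g : Y → Y') (x : X) (t : T Y) →
              st (f x , fmap g t) ≡ fmap (map f g) (st (x , t))
    st-unit : ∀ {X Y} (x : X) (t : T Y) → fmap proj₂ (st (x , t)) ≡ t
    st-assoc : ∀ {X Y Z} (x : X) (y : Y) (t : T Z) →
              fmap (λ p → proj₁ (proj₁ p) , (proj₂ (proj₁ p) , proj₂ p)) (st ((x , y) , t))
                ≡ st (x , st (y , t))
    st-η    : ∀ {X Y} (x : X) (y : Y) → st (x , η y) ≡ η (x , y)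
    st-μ    : ∀ {X Y} (x : X) (t : T (T Y)) →
              st (x , μ t) ≡ μ (fmap st (st (x , t)))

Handler : (T : Sig → Set → Set) → Sig → Sig → Set → Set
Handler T S S' X = (o : Op S) → A S o × (B S o → T S' X) → T S' X

record IsLambdaEffModel (T : Sig → Set → Set)
    (fmap : ∀ S {X Y : Set} → (X → Y) → T S X → T S Y)
    (η : ∀ S {X : Set} → X → T S X)
    (μ : ∀ S {X : Set} → T S (T S X) → T S X)
    (st : ∀ S {X Y : Set} → X × T S Y → T S (X × Y))
    (⟦_⟧ : ∀ S (o : Op S) → A S o → T S (B S o))
    (handle : ∀ S S' X → Handler T S S' X × T S (T S' X) → T S' X) : Set₁ where
  field
    strongMonad : ∀ S → IsStrongMonad (T S) (fmap S) (η S) (μ S) (st S)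
    handle-η : ∀ S S' X (h : Handler T S S' X) (c : T S' X) →
               handle S S' X (h , η S c) ≡ c
    -- handle ∘ (id × μ) = handle ∘ (id × T handle) ∘ ⟨π₁, st⟩
    handle-μ : ∀ S S' X (h : Handler T S S' X) (t : T S (T S (T S' X))) →
               handle S S' X (h , μ S t)
                 ≡ handle S S' X (h , fmap S (handle S S' X) (st S (h , t)))
    -- handle ∘ (id × a_op) = ev ∘ (π_op × id)
    handle-op : ∀ S S' X (h : Handler T S S' X) (o : Op S)
                (a : A S o) (k : B S o → T S' X) →
                handle S S' X
                  (h , fmap S (λ p → proj₁ p (proj₂ p)) (st S (k , ⟦ S ⟧ o a)))
                  ≡ h o (a , k)

F : Sig → Set → Set
F S X = Σ (Op S) λ o → A S o × (B S o → X)

data Free (S : Sig) (X : Set) : Set where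
  pure : X → Free S X
  op   : (o : Op S) → A S o → (B S o → Free S X) → Free S X

fmapF : ∀ S {X Y : Set} → (X → Y) → Free S X → Free S Y
fmapF S f (pure x)   = pure (f x)
fmapF S f (op o a k) = op o a (λ b → fmapF S f (k b))

ηF : ∀ S {X : Set} → X → Free S X
ηF S = pure

μF : ∀ S {X : Set} → Free S (Free S X) → Free S X
μF S (pure t)   = t
μF S (op o a k) = op o a (λ b → μF S (k b))

stF : ∀ S {X Y : Set} → X × Free S Y → Free S (X × Y)
stF S (x , t) = fmapF S (x ,_) t

ζ : ∀ S {X : Set} → F S X → Free S X
ζ S (o , a , k) = op o a (λ b → pure (k b))

⟦_⟧F : ∀ S (o : Op S) → A S o → Free S (B S o)
⟦ S ⟧F o a = ζ S (o , a , id)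

toAlg : ∀ S S' X → Handler Free S S' X → F S (Free S' X) → Free S' X
toAlg S S' X h (o , a , k) = h o (a , k)

-- Eilenberg–Moore T_S-algebra induced by an F_S-algebra (fold),
-- the unique one with  fold α ∘ ζ = α
foldF : ∀ S {Y : Set} → (F S Y → Y) → Free S Y → Y
foldF S α (pure y)   = y
foldF S α (op o a k) = α (o , a , λ b → foldF S α (k b))

handleF : ∀ S S' X → Handler Free S S' X × Free S (Free S' X) → Free S' X
handleF S S' X (h , t) = foldF S (toAlg S S' X h) t

{-# OPTIONS --safe #-}
module Submission where

-- Free S is the inductive free monad on the polynomial functor F S, so every
-- monad law is a structural induction (function extensionality identifies the
-- continuations). The strength is fmapF of a pairing, so the strength laws are
-- instances of the functor laws and naturality of μF. A handler is an F S-algebra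
-- and handle is its fold: the unit and operation laws hold by computation, and
-- the multiplication law is the statement that a fold is an Eilenberg–Moore algebra.

open import Defs
open import Level using (0ℓ)
open import Axiom.Extensionality.Propositional using (Extensionality)
open import Data.Product using (_,_)
open import Function using (id; _∘_)
open import Relation.Binary.PropositionalEquality using (_≡_; refl; sym; trans; cong)

module FreeMonadLaws (ext : Extensionality 0ℓ 0ℓ) (S : Sig) where

  fmapF-id : ∀ {X} (t : Free S X) → fmapF S id t ≡ t
  fmapF-id (pure x)   = refl
  fmapF-id (op o a k) = cong (op o a) (ext λ b → fmapF-id (k b))

  fmapF-∘ : ∀ {X Y Z} (f : X → Y) (g : Y → Z) (t : Free S X) →
            fmapF S (g ∘ f) t ≡ fmapF S g (fmapF S f t)
  fmapF-∘ f g (pure x)   = refl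
  fmapF-∘ f g (op o a k) = cong (op o a) (ext λ b → fmapF-∘ f g (k b))

  μF-natural : ∀ {X Y} (f : X → Y) (t : Free S (Free S X)) →
               fmapF S f (μF S t) ≡ μF S (fmapF S (fmapF S f) t)
  μF-natural f (pure u)   = refl
  μF-natural f (op o a k) = cong (op o a) (ext λ b → μF-natural f (k b))

  μF-fmapF-ηF : ∀ {X} (t : Free S X) → μF S (fmapF S (ηF S) t) ≡ t
  μF-fmapF-ηF (pure x)   = refl
  μF-fmapF-ηF (op o a k) = cong (op o a) (ext λ b → μF-fmapF-ηF (k b))

  μF-assoc : ∀ {X} (t : Free S (Free S (Free S X))) →
             μF S (fmapF S (μF S) t) ≡ μF S (μF S t)
  μF-assoc (pure u)   = refl
  μF-assoc (op o a k) = cong (op o a) (ext λ b → μF-assoc (k b))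

  stF-μF : ∀ {X Y} (x : X) (t : Free S (Free S Y)) →
           stF S (x , μF S t) ≡ μF S (fmapF S (stF S) (stF S (x , t)))
  stF-μF x t = trans (μF-natural (x ,_) t) (cong (μF S) (fmapF-∘ (x ,_) (stF S) t))

  foldF-μF : ∀ {Y} (α : F S Y → Y) (t : Free S (Free S Y)) →
             foldF S α (μF S t) ≡ foldF S α (fmapF S (foldF S α) t)
  foldF-μF α (pure u)   = refl
  foldF-μF α (op o a k) = cong (λ k′ → α (o , a , k′)) (ext λ b → foldF-μF α (k b))

  isStrongMonad : IsStrongMonad (Free S) (fmapF S) (ηF S) (μF S) (stF S)
  isStrongMonad = record
    { fmap-id  = fmapF-id
    ; fmap-∘   = fmapF-∘
    ; η-nat    = λ f x → refl
    ; μ-nat    = μF-natural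
    ; μ-η      = λ t → refl
    ; μ-Tη     = μF-fmapF-ηF
    ; μ-Tμ     = μF-assoc
    ; st-nat   = λ f g x t → trans (sym (fmapF-∘ g (f x ,_) t)) (fmapF-∘ (x ,_) _ t)
    ; st-unit  = λ x t → trans (sym (fmapF-∘ (x ,_) _ t)) (fmapF-id t)
    ; st-assoc = λ x y t → trans (sym (fmapF-∘ ((x , y) ,_) _ t)) (fmapF-∘ (y ,_) (x ,_) t)
    ; st-η     = λ x y → refl
    ; st-μ     = stF-μF
    }

open FreeMonadLaws

handleF-μF : (ext : Extensionality 0ℓ 0ℓ) → ∀ S S' X (h : Handler Free S S' X)
             (t : Free S (Free S (Free S' X))) →
             handleF S S' X (h , μF S t)
               ≡ handleF S S' X (h , fmapF S (handleF S S' X) (stF S (h , t)))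
handleF-μF ext S S' X h t =
  trans (foldF-μF ext S α t) (cong (foldF S α) (fmapF-∘ ext S (h ,_) (handleF S S' X) t))
  where
  α : F S (Free S' X) → Free S' X
  α = toAlg S S' X h

proposition5p3 : Extensionality 0ℓ 0ℓ →
    IsLambdaEffModel Free fmapF ηF μF stF ⟦_⟧F handleF
proposition5p3 ext = record
  { strongMonad = isStrongMonad ext
  ; handle-η    = λ S S' X h c → refl
  ; handle-μ    = handleF-μF ext
  ; handle-op   = λ S S' X h o a k → refl
  }
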